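{- Assume the setting described in the context. For every $v\in\{0,\dots,\tau-1\}$ and every integer $u\ge1$, $$\frac{m^{f_v}\lambda_{v+1,u}+a_v}{l^{e_v}}=\lambda_{v,u}+l^{\overline{E}_{v,u-1}}\,c_{v-u,u}.$$
   Context: Setting. Let $m,l\ge 2$ be coprime integers and $\tau\ge1$ an integer. Let $f_0,\dots,f_{\tau-1}$ be positive integers. Let $(a_{v,i})$, $v\in\{0,\dots,\tau-1\}$, $i\in\{0,\dots,l-1\}$, be integers with $a_{v,0}=0$ and, for $i\neq0$: $a_{v,i}\equiv -m^{f_v}i \pmod l$, $a_{v,i}\not\equiv0\pmod m$ and $a_{v,i}\not\equiv 0\pmod l$. For each $v\in\{0,\dots,\tau-1\}$ fix an admissible choice: an index $i_v\in\{1,\dots,l-1\}$, with $a_v:=a_{v,i_v}$; an integer $s_v$ with $1\le s_v\le m^{f_v}-1$ and $\gcd(s_v,m)=1$; and positive integers $e_v,r_v$ with $r_v\equiv i_v\pmod l$, $l^{e_v}s_v=m^{f_v}r_v+a_v$, and $|a_v|<\max(m^{f_v},l^{e_v})$. All indexed quantities are extended $\tau$-periodically to all integer indices. Sums. $\overline{E}_{v,u}=\sum_{y=0}^{u-1}e_{v-1-y}$ for $v\in\mathbb Z$, $u\ge0$. Iterates. Let $\mathbb Z_{\langle m,l\rangle}$ be the subring of $\mathbb Q$ of fractions whose denominators are coprime to both $m$ and $l$. Let $(n_v)_{v\in\mathbb Z}$ be a $\tau$-periodic sequence in $\mathbb Z_{\langle m,l\rangle}$ with $n_v\equiv s_v\pmod{m^{f_v}}$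 and $n_{v+1}=l^{e_v}\frac{n_v-s_v}{m^{f_v}}+r_v$ for all $v$. Graded digits. $k_{v,0}=n_v$, $k_{v,u}=m^{f_{v+u}}k_{v,u+1}+d_{v,u}$ with $d_{v,u}\in\{0,\dots,m^{f_{v+u}}-1\}$, $k_{v,u+1}\in\mathbb Z_{\langle m,l\rangle}$; $j_{v,0}=n_v$, $j_{v,u}=l^{e_{v-1-u}}j_{v,u+1}+b_{v,u}$ with $b_{v,u}\in\{0,\dots,l^{e_{v-1-u}}-1\}$, $j_{v,u+1}\in\mathbb Z_{\langle m,l\rangle}$. First subscripts are taken modulo $\tau$. Digit differences and residues. $c_{v,0}=a_v$ and $c_{v,u}=d_{v+1,u-1}-b_{v+u,u-1}$ for $u\ge1$. The $\mathbf l$-residue of index $u$ of $n_v$ is $\lambda_{v,u}=\sum_{w=0}^{u-1}l^{\overline{E}_{v,w}}b_{v,w}$. -}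

module Defs where

open import Data.Nat as ℕ using (ℕ; zero; suc; _^_; _≤_; _<_; NonZero; s≤s)
open import Data.Nat.Properties using (m^n≢0)
open import Data.Nat.Coprimality using (Coprime)
open import Data.Integer as ℤ using (ℤ; +_; ∣_∣)
import Data.Integer.Divisibility as ℤDiv
open import Data.Rational as ℚ using (ℚ; ↧ₙ_; _/_)
open import Data.Product using (_×_)
open import Relation.Nullary using (¬_)
open import Relation.Binary.PropositionalEquality using (_≡_)

powNZ : ∀ {x} → 2 ≤ x → ∀ k → NonZero (x ^ k)
powNZ {suc (suc x)} (s≤s (s≤s _)) k = m^n≢0 (suc (suc x)) k

_÷ℕ_ : ℚ → (d : ℕ) → .{{NonZero d}} → ℚ
q ÷ℕ d = q ℚ.* (ℤ.1ℤ / d)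

ℤtoℚ : ℤ → ℚ
ℤtoℚ z = z / 1

ℕtoℚ : ℕ → ℚ
ℕtoℚ n = (+ n) / 1

InZ⟨_,_⟩ : ℕ → ℕ → ℚ → Set
InZ⟨ m , l ⟩ q = Coprime (↧ₙ q) m × Coprime (↧ₙ q) l

max : ℕ → ℕ → ℕ
max = ℕ._⊔_

-- The setting.  All indexed quantities are given as ℤ-indexed,
-- τ-periodic sequences.

record Setting : Set where
  field
    m l τ : ℕ
    2≤m : 2 ≤ m
    2≤l : 2 ≤ l
    m⊥l : Coprime m l
    1≤τ : 1 ≤ τ
    f : ℤ → ℕ
    f-pos : ∀ v → 1 ≤ f v
    f-per : ∀ v → f (v ℤ.+ + τ) ≡ f v
    A : ℤ → ℕ → ℤ
    A-per : ∀ v i → A (v ℤ.+ + τ) i ≡ A v i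
    A-zero : ∀ v → A v 0 ≡ ℤ.0ℤ
    A-congl : ∀ v i → 1 ≤ i → i < l → (+ l) ℤDiv.∣ (A v i ℤ.+ (+ (m ^ f v ℕ.* i)))
    A-ndivm : ∀ v i → 1 ≤ i → i < l → ¬ ((+ m) ℤDiv.∣ A v i)
    A-ndivl : ∀ v i → 1 ≤ i → i < l → ¬ ((+ l) ℤDiv.∣ A v i)
    i : ℤ → ℕ
    i-per : ∀ v → i (v ℤ.+ + τ) ≡ i v
    i-range : ∀ v → 1 ≤ i v × i v < l
    s : ℤ → ℕ
    s-per : ∀ v → s (v ℤ.+ + τ) ≡ s v
    s-range : ∀ v → 1 ≤ s v × s v < m ^ f v
    s-cop : ∀ v → Coprime (s v) m
    e : ℤ → ℕ
    e-pos : ∀ v → 1 ≤ e v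
    e-per : ∀ v → e (v ℤ.+ + τ) ≡ e v
    r : ℤ → ℕ
    r-pos : ∀ v → 1 ≤ r v
    r-per : ∀ v → r (v ℤ.+ + τ) ≡ r v
    r-cong : ∀ v → (+ l) ℤDiv.∣ ((+ r v) ℤ.- (+ i v))

  a : ℤ → ℤ
  a v = A v (i v)

  field
    key-eq : ∀ v → (+ (l ^ e v ℕ.* s v)) ≡ (+ (m ^ f v ℕ.* r v)) ℤ.+ a v
    a-bound : ∀ v → ∣ a v ∣ < max (m ^ f v) (l ^ e v)
    n : ℤ → ℚ
    n-per : ∀ v → n (v ℤ.+ + τ) ≡ n v
    n-in : ∀ v → InZ⟨ m , l ⟩ (n v)
    -- n_v ≡ s_v (mod m^{f_v}) in ℤ_⟨m,l⟩
    n-cong : ∀ v → InZ⟨ m , l ⟩ ((_÷ℕ_ (n v ℚ.- ℕtoℚ (s v)) (m ^ f v) {{powNZ 2≤m (f v)}}))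
    n-rec : ∀ v → n (v ℤ.+ ℤ.1ℤ) ≡
              ℕtoℚ (l ^ e v) ℚ.* (_÷ℕ_ (n v ℚ.- ℕtoℚ (s v)) (m ^ f v) {{powNZ 2≤m (f v)}})
                ℚ.+ ℕtoℚ (r v)

  Ē : ℤ → ℕ → ℕ
  Ē v zero = 0
  Ē v (suc u) = Ē v u ℕ.+ e (v ℤ.- ℤ.1ℤ ℤ.- + u)

-- Graded digits of the iterates (characterised by their defining equations;
-- they are uniquely determined by the sequence n).

record Digits (S : Setting) : Set where
  open Setting S
  field
    k : ℤ → ℕ → ℚ
    d : ℤ → ℕ → ℕ
    k-zero : ∀ v → k v 0 ≡ n v
    k-step : ∀ v u → k v u ≡ ℕtoℚ (m ^ f (v ℤ.+ + u)) ℚ.* k v (suc u) ℚ.+ ℕtoℚ (d v u)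
    d-range : ∀ v u → d v u < m ^ f (v ℤ.+ + u)
    k-in : ∀ v u → InZ⟨ m , l ⟩ (k v u)
    j : ℤ → ℕ → ℚ
    b : ℤ → ℕ → ℕ
    j-zero : ∀ v → j v 0 ≡ n v
    j-step : ∀ v u → j v u ≡ ℕtoℚ (l ^ e (v ℤ.- ℤ.1ℤ ℤ.- + u)) ℚ.* j v (suc u) ℚ.+ ℕtoℚ (b v u)
    b-range : ∀ v u → b v u < l ^ e (v ℤ.- ℤ.1ℤ ℤ.- + u)
    j-in : ∀ v u → InZ⟨ m , l ⟩ (j v u)

  c : ℤ → ℕ → ℤ
  c v zero = a v
  c v (suc u) = (+ d (v ℤ.+ ℤ.1ℤ) u) ℤ.- (+ b (v ℤ.+ + suc u) u)

  λres : ℤ → ℕ → ℕ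
  λres v zero = 0
  λres v (suc u) = λres v u ℕ.+ l ^ Ē v u ℕ.* b v u

module Submission where

-- Write u = u'+1.  Two facts tie the m-adic quotients k and the l-adic quotients j
-- together: (i) k_{w+1,u} = l^{e_w} k_{w,u+1} + ρ with a digit ρ < l^{e_w}, by induction
-- on u starting from the iteration itself; (ii) hence j_{v,u} = k_{v−u,u}.  Both rest on
-- a digit lemma: a rational q with denominator coprime to B and B·q = A − d, where
-- d < B and A < L·B, is a natural number below L.  (This is where n_v ∈ ℤ⟨m,l⟩ is used,
-- and the bound on |a_v| enters through r_v < l^{e_v}.)  Feeding
--   n_v = λ_{v,u'} + l^{Ē_{v,u'}} (m^{f_v} j_{v+1,u} + d_{v−u',u'}),  n_{v+1} = λ_{v+1,u} + l^{e_v} l^{Ē_{v,u'}} j_{v+1,u}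
-- into l^{e_v} n_v = m^{f_v} n_{v+1} + a_v, the j-terms cancel, and the remaining bracket
-- λ_{v,u'} + l^{Ē_{v,u'}} d_{v−u',u'} equals λ_{v,u} + l^{Ē_{v,u'}} c_{v−u,u}.

open import Defs
open import Data.Nat as ℕ using (ℕ; _≤_; _<_; _^_; _∸_)
open import Data.Integer as ℤ using (ℤ; +_)
open import Data.Rational as ℚ using (ℚ; _/_)
open import Relation.Binary.PropositionalEquality using (_≡_)
open import Data.Nat using (zero; suc; NonZero)
import Data.Nat.Properties as ℕP
import Data.Integer.Properties as ℤP
import Data.Rational.Properties as ℚP
import Data.Rational.Unnormalised as ℚᵘ
import Data.Rational.Unnormalised.Properties as ℚᵘP
open import Data.Rational.Unnormalised using (mkℚᵘ; *≡*)
open import Relation.Binary.PropositionalEquality using (refl; sym; trans; cong; cong₂; subst; module ≡-Reasoning)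
open import Data.Integer.Tactic.RingSolver using () renaming (solve-∀ to ℤ-solve-∀)
open import Data.Rational.Solver using (module +-*-Solver)
open import Data.Nat.Solver using () renaming (module +-*-Solver to NatSolver)
open import Data.Product using (Σ; _×_; _,_; proj₁; proj₂)
open import Data.Nat.Coprimality as Coprimality using (Coprime)
import Data.Nat.Divisibility as ℕDiv
import Data.Integer.Divisibility as ℤDivᵤ
import Data.Integer.Divisibility.Signed as ℤDiv
import Data.Integer.Coprimality as ℤCoprimality
open import Data.Empty using (⊥-elim)
open import Relation.Nullary using (¬_; yes; no)

toℚᵘ-ℤtoℚ : ∀ z → ℚ.toℚᵘ (ℤtoℚ z) ℚᵘ.≃ mkℚᵘ z 0
toℚᵘ-ℤtoℚ z = ℚP.toℚᵘ-fromℚᵘ (mkℚᵘ z 0)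

ℤtoℚ-+ : ∀ x y → ℤtoℚ (x ℤ.+ y) ≡ ℤtoℚ x ℚ.+ ℤtoℚ y
ℤtoℚ-+ x y = ℚP.toℚᵘ-injective (begin
    ℚ.toℚᵘ (ℤtoℚ (x ℤ.+ y))                   ≈⟨ toℚᵘ-ℤtoℚ (x ℤ.+ y) ⟩
    mkℚᵘ (x ℤ.+ y) 0                          ≈⟨ *≡* (cong (ℤ._* ℤ.1ℤ) (sym (cong₂ ℤ._+_ (ℤP.*-identityʳ x) (ℤP.*-identityʳ y)))) ⟩
    mkℚᵘ x 0 ℚᵘ.+ mkℚᵘ y 0                    ≈⟨ ℚᵘP.+-cong (toℚᵘ-ℤtoℚ x) (toℚᵘ-ℤtoℚ y) ⟨
    ℚ.toℚᵘ (ℤtoℚ x) ℚᵘ.+ ℚ.toℚᵘ (ℤtoℚ y)      ≈⟨ ℚP.toℚᵘ-homo-+ (ℤtoℚ x) (ℤtoℚ y) ⟨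
    ℚ.toℚᵘ (ℤtoℚ x ℚ.+ ℤtoℚ y)                ∎)
  where open ℚᵘP.≃-Reasoning

ℤtoℚ-* : ∀ x y → ℤtoℚ (x ℤ.* y) ≡ ℤtoℚ x ℚ.* ℤtoℚ y
ℤtoℚ-* x y = ℚP.toℚᵘ-injective (begin
    ℚ.toℚᵘ (ℤtoℚ (x ℤ.* y))                   ≈⟨ toℚᵘ-ℤtoℚ (x ℤ.* y) ⟩
    mkℚᵘ (x ℤ.* y) 0                          ≈⟨ *≡* refl ⟩
    mkℚᵘ x 0 ℚᵘ.* mkℚᵘ y 0                    ≈⟨ ℚᵘP.*-cong (toℚᵘ-ℤtoℚ x) (toℚᵘ-ℤtoℚ y) ⟨
    ℚ.toℚᵘ (ℤtoℚ x) ℚᵘ.* ℚ.toℚᵘ (ℤtoℚ y)      ≈⟨ ℚP.toℚᵘ-homo-* (ℤtoℚ x) (ℤtoℚ y) ⟨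
    ℚ.toℚᵘ (ℤtoℚ x ℚ.* ℤtoℚ y)                ∎)
  where open ℚᵘP.≃-Reasoning

ℤtoℚ-neg : ∀ x → ℤtoℚ (ℤ.- x) ≡ ℚ.- ℤtoℚ x
ℤtoℚ-neg x = ℚP.toℚᵘ-injective (begin
    ℚ.toℚᵘ (ℤtoℚ (ℤ.- x))      ≈⟨ toℚᵘ-ℤtoℚ (ℤ.- x) ⟩
    mkℚᵘ (ℤ.- x) 0             ≈⟨ *≡* refl ⟩
    ℚᵘ.- mkℚᵘ x 0              ≈⟨ ℚᵘP.-‿cong (toℚᵘ-ℤtoℚ x) ⟨
    ℚᵘ.- ℚ.toℚᵘ (ℤtoℚ x)       ≈⟨ ℚP.toℚᵘ-homo‿- (ℤtoℚ x) ⟨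
    ℚ.toℚᵘ (ℚ.- ℤtoℚ x)        ∎)
  where open ℚᵘP.≃-Reasoning

ℤtoℚ-- : ∀ x y → ℤtoℚ (x ℤ.- y) ≡ ℤtoℚ x ℚ.- ℤtoℚ y
ℤtoℚ-- x y = trans (ℤtoℚ-+ x (ℤ.- y)) (cong (ℤtoℚ x ℚ.+_) (ℤtoℚ-neg y))

ℤtoℚ-injective : ∀ {x y} → ℤtoℚ x ≡ ℤtoℚ y → x ≡ y
ℤtoℚ-injective {x} {y} eq with ℚᵘP.≃-trans (ℚᵘP.≃-sym (toℚᵘ-ℤtoℚ x)) (ℚᵘP.≃-trans (ℚP.toℚᵘ-cong eq) (toℚᵘ-ℤtoℚ y))
... | *≡* x*1≡y*1 = trans (sym (ℤP.*-identityʳ x)) (trans x*1≡y*1 (ℤP.*-identityʳ y))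

ℕtoℚ-+ : ∀ x y → ℕtoℚ (x ℕ.+ y) ≡ ℕtoℚ x ℚ.+ ℕtoℚ y
ℕtoℚ-+ x y = trans (cong ℤtoℚ (ℤP.pos-+ x y)) (ℤtoℚ-+ (+ x) (+ y))

ℕtoℚ-* : ∀ x y → ℕtoℚ (x ℕ.* y) ≡ ℕtoℚ x ℚ.* ℕtoℚ y
ℕtoℚ-* x y = trans (cong ℤtoℚ (ℤP.pos-* x y)) (ℤtoℚ-* (+ x) (+ y))

/-÷ℕ : ∀ z B .{{_ : NonZero B}} → z / B ≡ ℤtoℚ z ÷ℕ B
/-÷ℕ z (suc b) = ℚP.toℚᵘ-injective (begin
    ℚ.toℚᵘ (z / suc b)                                   ≈⟨ ℚP.toℚᵘ-fromℚᵘ (mkℚᵘ z b) ⟩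
    mkℚᵘ z b                                             ≈⟨ *≡* (cong₂ ℤ._*_ (sym (ℤP.*-identityʳ z)) (cong (λ k → + suc k) (ℕP.+-identityʳ b))) ⟩
    mkℚᵘ z 0 ℚᵘ.* mkℚᵘ ℤ.1ℤ b                            ≈⟨ ℚᵘP.*-cong (toℚᵘ-ℤtoℚ z) (ℚP.toℚᵘ-fromℚᵘ (mkℚᵘ ℤ.1ℤ b)) ⟨
    ℚ.toℚᵘ (ℤtoℚ z) ℚᵘ.* ℚ.toℚᵘ (ℤ.1ℤ / suc b)           ≈⟨ ℚP.toℚᵘ-homo-* (ℤtoℚ z) (ℤ.1ℤ / suc b) ⟨
    ℚ.toℚᵘ (ℤtoℚ z ÷ℕ suc b)                             ∎)
  where open ℚᵘP.≃-Reasoning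

ℕtoℚ-*-inverse : ∀ B .{{_ : NonZero B}} → ℕtoℚ B ℚ.* (ℤ.1ℤ / B) ≡ ℚ.1ℚ
ℕtoℚ-*-inverse (suc b) = trans (sym (/-÷ℕ (+ suc b) (suc b))) (ℚP.toℚᵘ-injective (begin
    ℚ.toℚᵘ (+ suc b / suc b)     ≈⟨ ℚP.toℚᵘ-fromℚᵘ (mkℚᵘ (+ suc b) b) ⟩
    mkℚᵘ (+ suc b) b             ≈⟨ *≡* (ℤP.*-comm (+ suc b) ℤ.1ℤ) ⟩
    mkℚᵘ ℤ.1ℤ 0                  ≈⟨ toℚᵘ-ℤtoℚ ℤ.1ℤ ⟨
    ℚ.toℚᵘ ℚ.1ℚ                  ∎))
  where open ℚᵘP.≃-Reasoning

÷ℕ-* : ∀ B .{{_ : NonZero B}} q → (ℕtoℚ B ℚ.* q) ÷ℕ B ≡ q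
÷ℕ-* B q = begin
    (ℕtoℚ B ℚ.* q) ℚ.* (ℤ.1ℤ / B)    ≡⟨ cong (ℚ._* (ℤ.1ℤ / B)) (ℚP.*-comm (ℕtoℚ B) q) ⟩
    (q ℚ.* ℕtoℚ B) ℚ.* (ℤ.1ℤ / B)    ≡⟨ ℚP.*-assoc q (ℕtoℚ B) (ℤ.1ℤ / B) ⟩
    q ℚ.* (ℕtoℚ B ℚ.* (ℤ.1ℤ / B))    ≡⟨ cong (q ℚ.*_) (ℕtoℚ-*-inverse B) ⟩
    q ℚ.* ℚ.1ℚ                       ≡⟨ ℚP.*-identityʳ q ⟩
    q                                ∎
  where open ≡-Reasoning

*-÷ℕ : ∀ B .{{_ : NonZero B}} q → ℕtoℚ B ℚ.* (q ÷ℕ B) ≡ q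
*-÷ℕ B q = trans (sym (ℚP.*-assoc (ℕtoℚ B) q (ℤ.1ℤ / B))) (÷ℕ-* B q)

ℕtoℚ-*-cancelˡ : ∀ B .{{_ : NonZero B}} {x y} → ℕtoℚ B ℚ.* x ≡ ℕtoℚ B ℚ.* y → x ≡ y
ℕtoℚ-*-cancelˡ B {x} {y} eq = trans (sym (÷ℕ-* B x)) (trans (cong (_÷ℕ B) eq) (÷ℕ-* B y))

/-unique : ∀ z B .{{_ : NonZero B}} q → ℤtoℚ z ≡ ℕtoℚ B ℚ.* q → z / B ≡ q
/-unique z B q eq = trans (/-÷ℕ z B) (trans (cong (_÷ℕ B) eq) (÷ℕ-* B q))

*-↧ₙ : ∀ q → q ℚ.* ℕtoℚ (ℚ.↧ₙ q) ≡ ℤtoℚ (ℚ.↥ q)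
*-↧ₙ q@(ℚ.mkℚ z d _) = ℚP.toℚᵘ-injective (begin
    ℚ.toℚᵘ (q ℚ.* ℕtoℚ (suc d))                  ≈⟨ ℚP.toℚᵘ-homo-* q (ℕtoℚ (suc d)) ⟩
    ℚ.toℚᵘ q ℚᵘ.* ℚ.toℚᵘ (ℕtoℚ (suc d))          ≈⟨ ℚᵘP.*-congˡ {ℚ.toℚᵘ q} (toℚᵘ-ℤtoℚ (+ suc d)) ⟩
    mkℚᵘ z d ℚᵘ.* mkℚᵘ (+ suc d) 0               ≈⟨ *≡* (trans (ℤP.*-identityʳ _) (cong (λ k → z ℤ.* + k) (sym (ℕP.*-identityʳ (suc d))))) ⟩
    mkℚᵘ z 0                                     ≈⟨ toℚᵘ-ℤtoℚ z ⟨
    ℚ.toℚᵘ (ℤtoℚ z)                              ∎)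
  where open ℚᵘP.≃-Reasoning

coprime-* : ∀ {a b c} → Coprime a b → Coprime a c → Coprime a (b ℕ.* c)
coprime-* {a} {b} a⊥b a⊥c {i} (i∣a , i∣bc) = a⊥c (i∣a , Coprimality.coprime-divisor i⊥b i∣bc)
  where
  i⊥b : Coprime i b
  i⊥b (j∣i , j∣b) = a⊥b (ℕDiv.∣-trans j∣i i∣a , j∣b)

coprime-^ : ∀ {a b} → Coprime a b → ∀ k → Coprime a (b ^ k)
coprime-^ {a} _ zero = Coprimality.sym (Coprimality.1-coprimeTo a)
coprime-^ a⊥b (suc k) = coprime-* a⊥b (coprime-^ a⊥b k)

-- Elements of
-- ℤ⟨m,l⟩ are m^k- and l^k-integral, and this is all the proof uses about them.
record Integral (B : ℕ) (q : ℚ) : Set where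
  constructor integral
  field
    den     : ℕ
    den⊥B   : Coprime den B
    num     : ℤ
    cleared : q ℚ.* ℕtoℚ den ≡ ℤtoℚ num

coprime-↧ₙ⇒integral : ∀ {q x} → Coprime (ℚ.↧ₙ q) x → ∀ k → Integral (x ^ k) q
coprime-↧ₙ⇒integral {q} ↧q⊥x k = integral (ℚ.↧ₙ q) (coprime-^ ↧q⊥x k) (ℚ.↥ q) (*-↧ₙ q)

integral-- : ∀ {B x y} → Integral B x → Integral B y → Integral B (x ℚ.- y)
integral-- {B} {x} {y} (integral D₁ D₁⊥B W₁ e₁) (integral D₂ D₂⊥B W₂ e₂) =
  integral (D₁ ℕ.* D₂) D₁D₂⊥B (W₁ ℤ.* + D₂ ℤ.- W₂ ℤ.* + D₁) (begin
    (x ℚ.- y) ℚ.* ℕtoℚ (D₁ ℕ.* D₂)                       ≡⟨ cong ((x ℚ.- y) ℚ.*_) (ℕtoℚ-* D₁ D₂) ⟩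
    (x ℚ.- y) ℚ.* (ℕtoℚ D₁ ℚ.* ℕtoℚ D₂)                  ≡⟨ solve 4 (λ x y a b → (x :- y) :* (a :* b) := (x :* a) :* b :- (y :* b) :* a)
                                                              refl x y (ℕtoℚ D₁) (ℕtoℚ D₂) ⟩
    (x ℚ.* ℕtoℚ D₁) ℚ.* ℕtoℚ D₂ ℚ.- (y ℚ.* ℕtoℚ D₂) ℚ.* ℕtoℚ D₁
                                                         ≡⟨ cong₂ (λ p q → p ℚ.* ℕtoℚ D₂ ℚ.- q ℚ.* ℕtoℚ D₁) e₁ e₂ ⟩
    ℤtoℚ W₁ ℚ.* ℕtoℚ D₂ ℚ.- ℤtoℚ W₂ ℚ.* ℕtoℚ D₁        ≡⟨ cong₂ ℚ._-_ (ℤtoℚ-* W₁ (+ D₂)) (ℤtoℚ-* W₂ (+ D₁)) ⟨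
    ℤtoℚ (W₁ ℤ.* + D₂) ℚ.- ℤtoℚ (W₂ ℤ.* + D₁)           ≡⟨ ℤtoℚ-- (W₁ ℤ.* + D₂) (W₂ ℤ.* + D₁) ⟨
    ℤtoℚ (W₁ ℤ.* + D₂ ℤ.- W₂ ℤ.* + D₁)                  ∎)
  where
  open ≡-Reasoning
  open +-*-Solver
  D₁D₂⊥B : Coprime (D₁ ℕ.* D₂) B
  D₁D₂⊥B = Coprimality.sym (coprime-* (Coprimality.sym D₁⊥B) (Coprimality.sym D₂⊥B))

integral-scale : ∀ {B} c {x} → Integral B x → Integral B (ℕtoℚ c ℚ.* x)
integral-scale c {x} (integral D D⊥B W e) = integral D D⊥B (+ c ℤ.* W) (begin
    (ℕtoℚ c ℚ.* x) ℚ.* ℕtoℚ D    ≡⟨ ℚP.*-assoc (ℕtoℚ c) x (ℕtoℚ D) ⟩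
    ℕtoℚ c ℚ.* (x ℚ.* ℕtoℚ D)    ≡⟨ cong (ℕtoℚ c ℚ.*_) e ⟩
    ℕtoℚ c ℚ.* ℤtoℚ W           ≡⟨ ℤtoℚ-* (+ c) W ⟨
    ℤtoℚ (+ c ℤ.* W)            ∎)
  where open ≡-Reasoning

-- A B-integral rational whose B-fold multiple is an integer is itself an
-- integer: clearing denominators gives B·W = D·t with D coprime to B, so B ∣ t.
integral-quotient : ∀ B .{{_ : NonZero B}} {q t} → Integral B q → ℕtoℚ B ℚ.* q ≡ ℤtoℚ t →
                    Σ ℤ λ z → q ≡ ℤtoℚ z × + B ℤ.* z ≡ t
integral-quotient B {q} {t} (integral D D⊥B W qD≡W) Bq≡t = z , q≡z , Bz≡t
  where
  open ≡-Reasoning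
  BW≡Dt : + B ℤ.* W ≡ + D ℤ.* t
  BW≡Dt = ℤtoℚ-injective (begin
    ℤtoℚ (+ B ℤ.* W)                      ≡⟨ ℤtoℚ-* (+ B) W ⟩
    ℕtoℚ B ℚ.* ℤtoℚ W                     ≡⟨ cong (ℕtoℚ B ℚ.*_) qD≡W ⟨
    ℕtoℚ B ℚ.* (q ℚ.* ℕtoℚ D)             ≡⟨ ℚP.*-assoc (ℕtoℚ B) q (ℕtoℚ D) ⟨
    (ℕtoℚ B ℚ.* q) ℚ.* ℕtoℚ D             ≡⟨ cong (ℚ._* ℕtoℚ D) Bq≡t ⟩
    ℤtoℚ t ℚ.* ℕtoℚ D                     ≡⟨ ℚP.*-comm (ℤtoℚ t) (ℕtoℚ D) ⟩
    ℕtoℚ D ℚ.* ℤtoℚ t                     ≡⟨ ℤtoℚ-* (+ D) t ⟨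
    ℤtoℚ (+ D ℤ.* t)                      ∎)
  B∣Dt : + B ℤDivᵤ.∣ (+ D ℤ.* t)
  B∣Dt = subst (λ x → B ℕDiv.∣ ℤ.∣ x ∣) BW≡Dt (subst (B ℕDiv.∣_) (sym (ℤP.abs-* (+ B) W)) (ℕDiv.m∣m*n ℤ.∣ W ∣))
  B∣t : + B ℤDiv.∣ t
  B∣t = ℤDiv.∣ᵤ⇒∣ (ℤCoprimality.coprime-divisor (+ B) (+ D) t (Coprimality.sym D⊥B) B∣Dt)
  z : ℤ
  z = ℤDiv._∣_.quotient B∣t
  Bz≡t : + B ℤ.* z ≡ t
  Bz≡t = trans (ℤP.*-comm (+ B) z) (sym (ℤDiv._∣_.equality B∣t))
  q≡z : q ≡ ℤtoℚ z
  q≡z = ℕtoℚ-*-cancelˡ B (trans Bq≡t (trans (cong ℤtoℚ (sym Bz≡t)) (ℤtoℚ-* (+ B) z)))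

bounded-quotient : ∀ {B L A d} z → + B ℤ.* z ℤ.+ + d ≡ + A → d < B → A < L ℕ.* B →
                   Σ ℕ λ r → r < L × z ≡ + r
bounded-quotient {B} {L} {A} {d} (+ r) Br+d≡A _ A<LB = r , r<L , refl
  where
  Br+d≡Aℕ : B ℕ.* r ℕ.+ d ≡ A
  Br+d≡Aℕ = ℤP.+-injective (trans (cong (ℤ._+ + d) (ℤP.pos-* B r)) Br+d≡A)
  r<L : r < L
  r<L = ℕP.*-cancelˡ-< B r L (begin-strict
    B ℕ.* r          ≤⟨ ℕP.m≤m+n (B ℕ.* r) d ⟩
    B ℕ.* r ℕ.+ d    ≡⟨ Br+d≡Aℕ ⟩
    A                <⟨ A<LB ⟩
    L ℕ.* B          ≡⟨ ℕP.*-comm L B ⟩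
    B ℕ.* L          ∎)
    where open ℕP.≤-Reasoning
bounded-quotient {B} {L} {A} {d} ℤ.-[1+ r ] B[-1-r]+d≡A d<B _ = ⊥-elim (ℕP.<⇒≱ d<B B≤d)
  where
  -- a negative quotient would force the remainder d = A + B·(1+r) ≥ B
  d≡A+B[1+r] : + d ≡ + A ℤ.+ + B ℤ.* + suc r
  d≡A+B[1+r] = trans (regroup (+ B) (+ suc r) (+ d)) (cong (ℤ._+ + B ℤ.* + suc r) B[-1-r]+d≡A)
    where
    regroup : ∀ b x d → d ≡ (b ℤ.* ℤ.- x ℤ.+ d) ℤ.+ b ℤ.* x
    regroup = ℤ-solve-∀
  d≡A+B[1+r]ℕ : d ≡ A ℕ.+ B ℕ.* suc r
  d≡A+B[1+r]ℕ = ℤP.+-injective (trans d≡A+B[1+r] (cong (ℤ._+_ (+ A)) (sym (ℤP.pos-* B (suc r)))))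
  B≤d : B ≤ d
  B≤d = begin
    B                    ≤⟨ ℕP.m≤m*n B (suc r) ⟩
    B ℕ.* suc r          ≤⟨ ℕP.m≤n+m (B ℕ.* suc r) A ⟩
    A ℕ.+ B ℕ.* suc r    ≡⟨ d≡A+B[1+r]ℕ ⟨
    d                    ∎
    where open ℕP.≤-Reasoning

-+-cancel : ∀ v x → v ℤ.- x ℤ.+ x ≡ v
-+-cancel = ℤ-solve-∀

-1-+1 : ∀ v x → v ℤ.- ℤ.1ℤ ℤ.- x ℤ.+ ℤ.1ℤ ≡ v ℤ.- x
-1-+1 = ℤ-solve-∀

-suc : ∀ v x → v ℤ.- (ℤ.1ℤ ℤ.+ x) ≡ v ℤ.- ℤ.1ℤ ℤ.- x
-suc = ℤ-solve-∀

+1-suc : ∀ v x → v ℤ.+ ℤ.1ℤ ℤ.- (ℤ.1ℤ ℤ.+ x) ≡ v ℤ.- x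
+1-suc = ℤ-solve-∀

+1-1 : ∀ v x → v ℤ.+ ℤ.1ℤ ℤ.- ℤ.1ℤ ℤ.- x ≡ v ℤ.- x
+1-1 = ℤ-solve-∀

integral-digit : ∀ B .{{_ : NonZero B}} {L A d q} → Integral B q →
                 ℕtoℚ B ℚ.* q ≡ ℕtoℚ A ℚ.- ℕtoℚ d → d < B → A < L ℕ.* B →
                 Σ ℕ λ r → r < L × q ≡ ℕtoℚ r
integral-digit B {L} {A} {d} {q} q-int Bq≡A-d d<B A<LB =
  conclude (integral-quotient B q-int (trans Bq≡A-d (sym (ℤtoℚ-- (+ A) (+ d)))))
  where
  conclude : (Σ ℤ λ z → q ≡ ℤtoℚ z × + B ℤ.* z ≡ + A ℤ.- + d) → Σ ℕ λ r → r < L × q ≡ ℕtoℚ r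
  conclude (z , q≡z , Bz≡A-d) = natural (bounded-quotient z Bz+d≡A d<B A<LB)
    where
    Bz+d≡A : + B ℤ.* z ℤ.+ + d ≡ + A
    Bz+d≡A = trans (cong (ℤ._+ + d) Bz≡A-d) (-+-cancel (+ A) (+ d))
    natural : (Σ ℕ λ r → r < L × z ≡ + r) → Σ ℕ λ r → r < L × q ≡ ℕtoℚ r
    natural (r , r<L , z≡r) = r , r<L , trans q≡z (cong ℤtoℚ z≡r)

euclid-unique : ∀ B .{{_ : NonZero B}} y y' {x x'} → Integral B (y ℚ.- y') → x < B → x' < B →
                ℕtoℚ B ℚ.* y ℚ.+ ℕtoℚ x ≡ ℕtoℚ B ℚ.* y' ℚ.+ ℕtoℚ x' → y ≡ y'
euclid-unique B y y' {x} {x'} int x<B x'<B eq =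
  y-y'-zero (integral-digit B {L = 1} int B[y-y']≡x'-x x<B (subst (x' <_) (sym (ℕP.*-identityˡ B)) x'<B))
  where
  open ≡-Reasoning
  open +-*-Solver
  B[y-y']≡x'-x : ℕtoℚ B ℚ.* (y ℚ.- y') ≡ ℕtoℚ x' ℚ.- ℕtoℚ x
  B[y-y']≡x'-x = begin
    ℕtoℚ B ℚ.* (y ℚ.- y')
      ≡⟨ solve 5 (λ b y y' x x' → b :* (y :- y') := ((b :* y :+ x) :- (b :* y' :+ x')) :+ (x' :- x))
           refl (ℕtoℚ B) y y' (ℕtoℚ x) (ℕtoℚ x') ⟩
    ((ℕtoℚ B ℚ.* y ℚ.+ ℕtoℚ x) ℚ.- (ℕtoℚ B ℚ.* y' ℚ.+ ℕtoℚ x')) ℚ.+ (ℕtoℚ x' ℚ.- ℕtoℚ x)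
      ≡⟨ cong (λ t → (t ℚ.- (ℕtoℚ B ℚ.* y' ℚ.+ ℕtoℚ x')) ℚ.+ (ℕtoℚ x' ℚ.- ℕtoℚ x)) eq ⟩
    ((ℕtoℚ B ℚ.* y' ℚ.+ ℕtoℚ x') ℚ.- (ℕtoℚ B ℚ.* y' ℚ.+ ℕtoℚ x')) ℚ.+ (ℕtoℚ x' ℚ.- ℕtoℚ x)
      ≡⟨ solve 2 (λ t s → (t :- t) :+ s := s) refl (ℕtoℚ B ℚ.* y' ℚ.+ ℕtoℚ x') (ℕtoℚ x' ℚ.- ℕtoℚ x) ⟩
    ℕtoℚ x' ℚ.- ℕtoℚ x
      ∎
  -- the quotient difference is a natural number below 1, hence 0
  y-y'-zero : (Σ ℕ λ r → r < 1 × y ℚ.- y' ≡ ℕtoℚ r) → y ≡ y'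
  y-y'-zero (zero , _ , y-y'≡0) = begin
    y                      ≡⟨ solve 2 (λ y y' → y := (y :- y') :+ y') refl y y' ⟩
    (y ℚ.- y') ℚ.+ y'      ≡⟨ cong (ℚ._+ y') y-y'≡0 ⟩
    ℚ.0ℚ ℚ.+ y'            ≡⟨ ℚP.+-identityˡ y' ⟩
    y'                     ∎
  y-y'-zero (suc _ , ℕ.s≤s () , _)

∣^ : ∀ x k → 1 ≤ k → x ℕDiv.∣ x ^ k
∣^ x (suc k) _ = ℕDiv.m∣m*n (x ^ k)

mixed-radix-< : ∀ {L M x y} → x < M → y < L → L ℕ.* x ℕ.+ y < L ℕ.* M
mixed-radix-< {L} {M} {x} {y} x<M y<L = begin-strict
    L ℕ.* x ℕ.+ y       <⟨ ℕP.+-monoʳ-< (L ℕ.* x) y<L ⟩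
    L ℕ.* x ℕ.+ L       ≡⟨ ℕP.+-comm (L ℕ.* x) L ⟩
    L ℕ.+ L ℕ.* x       ≡⟨ ℕP.*-suc L x ⟨
    L ℕ.* suc x         ≤⟨ ℕP.*-monoʳ-≤ L x<M ⟩
    L ℕ.* M             ∎
  where open ℕP.≤-Reasoning

overshoot : ∀ {L M s R a} → + (L ℕ.* s) ≡ + (M ℕ.* R) ℤ.+ a → s < M → L < R → M ℕ.+ L ≤ ℤ.∣ a ∣
overshoot {L} {M} {s} {R} {a} Ls≡MR+a s<M L<R = begin
    M ℕ.+ L                                ≡⟨ ℕP.m+n∸m≡n (L ℕ.* s) (M ℕ.+ L) ⟨
    L ℕ.* s ℕ.+ (M ℕ.+ L) ∸ L ℕ.* s        ≤⟨ ℕP.∸-monoˡ-≤ (L ℕ.* s) Ls+M+L≤MR ⟩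
    M ℕ.* R ∸ L ℕ.* s                      ≡⟨ ∣a∣≡MR∸Ls ⟨
    ℤ.∣ a ∣                                ∎
  where
  open ℕP.≤-Reasoning
  Ls+M+L≤MR : L ℕ.* s ℕ.+ (M ℕ.+ L) ≤ M ℕ.* R
  Ls+M+L≤MR = begin
    L ℕ.* s ℕ.+ (M ℕ.+ L)    ≡⟨ solve 3 (λ x M L → x :+ (M :+ L) := M :+ (x :+ L)) refl (L ℕ.* s) M L ⟩
    M ℕ.+ (L ℕ.* s ℕ.+ L)    ≤⟨ ℕP.+-monoʳ-≤ M Ls+L≤LM ⟩
    M ℕ.+ L ℕ.* M            ≡⟨ solve 2 (λ M L → M :+ L :* M := M :* (con 1 :+ L)) refl M L ⟩
    M ℕ.* suc L              ≤⟨ ℕP.*-monoʳ-≤ M L<R ⟩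
    M ℕ.* R                  ∎
    where
    open NatSolver
    Ls+L≤LM : L ℕ.* s ℕ.+ L ≤ L ℕ.* M
    Ls+L≤LM = subst (_≤ L ℕ.* M) (trans (ℕP.*-suc L s) (ℕP.+-comm L (L ℕ.* s))) (ℕP.*-monoʳ-≤ L s<M)
  a≡Ls-MR : a ≡ + (L ℕ.* s) ℤ.- + (M ℕ.* R)
  a≡Ls-MR = trans (add-sub a (+ (M ℕ.* R))) (cong (ℤ._- + (M ℕ.* R)) (sym Ls≡MR+a))
    where
    add-sub : ∀ a y → a ≡ y ℤ.+ a ℤ.- y
    add-sub = ℤ-solve-∀
  ∣a∣≡MR∸Ls : ℤ.∣ a ∣ ≡ M ℕ.* R ∸ L ℕ.* s
  ∣a∣≡MR∸Ls = trans (cong ℤ.∣_∣ (trans a≡Ls-MR (ℤP.m-n≡m⊖n (L ℕ.* s) (M ℕ.* R))))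
                   (ℤP.∣⊖∣-≤ (ℕP.≤-trans (ℕP.m≤m+n (L ℕ.* s) (M ℕ.+ L)) Ls+M+L≤MR))

interleave-algebra : ∀ M L y₁ y₂ d₁ d₂ ρ {K₁ K₂ : ℚ} →
                     K₁ ≡ M ℚ.* y₁ ℚ.+ d₁ → K₂ ≡ M ℚ.* y₂ ℚ.+ d₂ → K₁ ≡ L ℚ.* K₂ ℚ.+ ρ →
                     M ℚ.* (y₁ ℚ.- L ℚ.* y₂) ≡ (L ℚ.* d₂ ℚ.+ ρ) ℚ.- d₁
interleave-algebra M L y₁ y₂ d₁ d₂ ρ refl refl eq = begin
    M ℚ.* (y₁ ℚ.- L ℚ.* y₂)
      ≡⟨ solve 6 (λ M L y₁ y₂ d₁ d₂ → M :* (y₁ :- L :* y₂) := ((M :* y₁ :+ d₁) :- L :* (M :* y₂ :+ d₂)) :+ (L :* d₂ :- d₁))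
           refl M L y₁ y₂ d₁ d₂ ⟩
    ((M ℚ.* y₁ ℚ.+ d₁) ℚ.- L ℚ.* K₂) ℚ.+ (L ℚ.* d₂ ℚ.- d₁)
      ≡⟨ cong (λ t → (t ℚ.- L ℚ.* K₂) ℚ.+ (L ℚ.* d₂ ℚ.- d₁)) eq ⟩
    ((L ℚ.* K₂ ℚ.+ ρ) ℚ.- L ℚ.* K₂) ℚ.+ (L ℚ.* d₂ ℚ.- d₁)
      ≡⟨ solve 5 (λ t L ρ d₁ d₂ → ((t :+ ρ) :- t) :+ (L :* d₂ :- d₁) := (L :* d₂ :+ ρ) :- d₁) refl (L ℚ.* K₂) L ρ d₁ d₂ ⟩
    (L ℚ.* d₂ ℚ.+ ρ) ℚ.- d₁
      ∎
  where
  open ≡-Reasoning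
  open +-*-Solver
  K₂ = M ℚ.* y₂ ℚ.+ d₂

carry : ∀ L M P J d a λ₀ λ₁ {n₀ n₁ : ℚ} →
        n₀ ≡ λ₀ ℚ.+ P ℚ.* (M ℚ.* J ℚ.+ d) → n₁ ≡ λ₁ ℚ.+ (L ℚ.* P) ℚ.* J → L ℚ.* n₀ ≡ M ℚ.* n₁ ℚ.+ a →
        M ℚ.* λ₁ ℚ.+ a ≡ L ℚ.* (λ₀ ℚ.+ P ℚ.* d)
carry L M P J d a λ₀ λ₁ refl refl eq = begin
    M ℚ.* λ₁ ℚ.+ a
      ≡⟨ solve 6 (λ M L P J a λ₁ → M :* λ₁ :+ a := (M :* (λ₁ :+ (L :* P) :* J) :+ a) :- M :* L :* P :* J) refl M L P J a λ₁ ⟩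
    (M ℚ.* (λ₁ ℚ.+ (L ℚ.* P) ℚ.* J) ℚ.+ a) ℚ.- M ℚ.* L ℚ.* P ℚ.* J
      ≡⟨ cong (ℚ._- M ℚ.* L ℚ.* P ℚ.* J) eq ⟨
    L ℚ.* (λ₀ ℚ.+ P ℚ.* (M ℚ.* J ℚ.+ d)) ℚ.- M ℚ.* L ℚ.* P ℚ.* J
      ≡⟨ solve 6 (λ M L P J d λ₀ → L :* (λ₀ :+ P :* (M :* J :+ d)) :- M :* L :* P :* J := L :* (λ₀ :+ P :* d)) refl M L P J d λ₀ ⟩
    L ℚ.* (λ₀ ℚ.+ P ℚ.* d)
      ∎
  where
  open ≡-Reasoning
  open +-*-Solver

module DigitIdentities (S : Setting) (D : Digits S) where
  open Setting S
  open Digits D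

  m^f≢0 : ∀ w → NonZero (m ^ f w)
  m^f≢0 w = powNZ 2≤m (f w)

  l^e≢0 : ∀ w → NonZero (l ^ e w)
  l^e≢0 w = powNZ 2≤l (e w)

  m-integral : ∀ q → InZ⟨ m , l ⟩ q → ∀ k → Integral (m ^ k) q
  m-integral _ (↧q⊥m , _) = coprime-↧ₙ⇒integral ↧q⊥m

  l-integral : ∀ q → InZ⟨ m , l ⟩ q → ∀ k → Integral (l ^ k) q
  l-integral _ (_ , ↧q⊥l) = coprime-↧ₙ⇒integral ↧q⊥l

  -- l ∤ r_w, since r_w ≡ i_w (mod l) with 0 < i_w < l.
  l∤r : ∀ w → ¬ (l ℕDiv.∣ r w)
  l∤r w l∣r = ℕP.<⇒≱ (proj₂ (i-range w)) (ℕDiv.∣⇒≤ {{ℕ.>-nonZero (proj₁ (i-range w))}} l∣i)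
    where
    r-[r-i]≡i : ∀ x y → x ℤ.- (x ℤ.- y) ≡ y
    r-[r-i]≡i = ℤ-solve-∀
    l∣i : l ℕDiv.∣ i w
    l∣i = ℤDiv.∣⇒∣ᵤ (subst (+ l ℤDiv.∣_) (r-[r-i]≡i (+ r w) (+ i w))
            (ℤDiv.∣m∣n⇒∣m-n (ℤDiv.∣ᵤ⇒∣ {+ l} {+ r w} l∣r) (ℤDiv.∣ᵤ⇒∣ {+ l} {+ r w ℤ.- + i w} (r-cong w))))

  -- r_w < l^{e_w}: as l ∣ l^{e_w} but l ∤ r_w, otherwise r_w > l^{e_w}, and then
  -- |a_w| ≥ m^{f_w} + l^{e_w} by the key equation, against the bound on a_w.
  r<l^e : ∀ w → r w < l ^ e w
  r<l^e w with r w ℕP.<? l ^ e w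
  ... | yes r<L = r<L
  ... | no r≮L = ⊥-elim (ℕP.<⇒≱ (a-bound w) (begin
        max (m ^ f w) (l ^ e w)    ≤⟨ ℕP.m⊔n≤m+n (m ^ f w) (l ^ e w) ⟩
        m ^ f w ℕ.+ l ^ e w        ≤⟨ overshoot {l ^ e w} {m ^ f w} {s w} {r w} {a w} (key-eq w) (proj₂ (s-range w)) L<r ⟩
        ℤ.∣ a w ∣                  ∎))
    where
    open ℕP.≤-Reasoning
    L<r : l ^ e w < r w
    L<r = ℕP.≤∧≢⇒< (ℕP.≮⇒≥ r≮L) (λ L≡r → l∤r w (subst (l ℕDiv.∣_) L≡r (∣^ l (e w) (e-pos w))))

  iterate-relation : ∀ w → ℕtoℚ (l ^ e w) ℚ.* n w ≡ ℕtoℚ (m ^ f w) ℚ.* n (w ℤ.+ ℤ.1ℤ) ℚ.+ ℤtoℚ (a w)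
  iterate-relation w = sym (begin
      ℕtoℚ M ℚ.* n (w ℤ.+ ℤ.1ℤ) ℚ.+ ℤtoℚ (a w)
        ≡⟨ cong (λ t → ℕtoℚ M ℚ.* t ℚ.+ ℤtoℚ (a w)) (n-rec w) ⟩
      ℕtoℚ M ℚ.* (ℕtoℚ L ℚ.* X ℚ.+ ℕtoℚ (r w)) ℚ.+ ℤtoℚ (a w)
        ≡⟨ solve 5 (λ M L X R A → M :* (L :* X :+ R) :+ A := L :* (M :* X) :+ (M :* R :+ A))
             refl (ℕtoℚ M) (ℕtoℚ L) X (ℕtoℚ (r w)) (ℤtoℚ (a w)) ⟩
      ℕtoℚ L ℚ.* (ℕtoℚ M ℚ.* X) ℚ.+ (ℕtoℚ M ℚ.* ℕtoℚ (r w) ℚ.+ ℤtoℚ (a w))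
        ≡⟨ cong₂ (λ p q → ℕtoℚ L ℚ.* p ℚ.+ q) (*-÷ℕ M (n w ℚ.- ℕtoℚ (s w))) (sym key) ⟩
      ℕtoℚ L ℚ.* (n w ℚ.- ℕtoℚ (s w)) ℚ.+ ℕtoℚ L ℚ.* ℕtoℚ (s w)
        ≡⟨ solve 3 (λ L x s → L :* (x :- s) :+ L :* s := L :* x) refl (ℕtoℚ L) (n w) (ℕtoℚ (s w)) ⟩
      ℕtoℚ L ℚ.* n w
        ∎)
    where
    open ≡-Reasoning
    open +-*-Solver
    M = m ^ f w
    L = l ^ e w
    instance
      M≢0 : NonZero M
      M≢0 = m^f≢0 w
    X = (n w ℚ.- ℕtoℚ (s w)) ÷ℕ M
    key : ℕtoℚ L ℚ.* ℕtoℚ (s w) ≡ ℕtoℚ M ℚ.* ℕtoℚ (r w) ℚ.+ ℤtoℚ (a w)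
    key = begin
      ℕtoℚ L ℚ.* ℕtoℚ (s w)                   ≡⟨ ℕtoℚ-* L (s w) ⟨
      ℤtoℚ (+ (L ℕ.* s w))                   ≡⟨ cong ℤtoℚ (key-eq w) ⟩
      ℤtoℚ (+ (M ℕ.* r w) ℤ.+ a w)           ≡⟨ ℤtoℚ-+ (+ (M ℕ.* r w)) (a w) ⟩
      ℕtoℚ (M ℕ.* r w) ℚ.+ ℤtoℚ (a w)        ≡⟨ cong (ℚ._+ ℤtoℚ (a w)) (ℕtoℚ-* M (r w)) ⟩
      ℕtoℚ M ℚ.* ℕtoℚ (r w) ℚ.+ ℤtoℚ (a w)  ∎

  -- The first m-adic digit of n_w is s_w, so k_{w,1} = (n_w − s_w) / m^{f_w}.
  first-quotient : ∀ w → k w 1 ≡ _÷ℕ_ (n w ℚ.- ℕtoℚ (s w)) (m ^ f w) {{m^f≢0 w}}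
  first-quotient w = euclid-unique M (k w 1) X (integral-- (m-integral (k w 1) (k-in w 1) (f w)) (m-integral X (n-cong w) (f w)))
                       d<M (proj₂ (s-range w)) (begin
      ℕtoℚ M ℚ.* k w 1 ℚ.+ ℕtoℚ (d w 0)                ≡⟨ cong (λ x → ℕtoℚ (m ^ f x) ℚ.* k w 1 ℚ.+ ℕtoℚ (d w 0)) w+0≡w ⟨
      ℕtoℚ (m ^ f (w ℤ.+ + 0)) ℚ.* k w 1 ℚ.+ ℕtoℚ (d w 0) ≡⟨ k-step w 0 ⟨
      k w 0                                            ≡⟨ k-zero w ⟩
      n w                                              ≡⟨ solve 2 (λ x s → x := (x :- s) :+ s) refl (n w) (ℕtoℚ (s w)) ⟩
      (n w ℚ.- ℕtoℚ (s w)) ℚ.+ ℕtoℚ (s w)              ≡⟨ cong (ℚ._+ ℕtoℚ (s w)) (*-÷ℕ M (n w ℚ.- ℕtoℚ (s w))) ⟨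
      ℕtoℚ M ℚ.* ((n w ℚ.- ℕtoℚ (s w)) ÷ℕ M) ℚ.+ ℕtoℚ (s w) ∎)
    where
    open ≡-Reasoning
    open +-*-Solver
    M = m ^ f w
    instance
      M≢0 : NonZero M
      M≢0 = m^f≢0 w
    X = (n w ℚ.- ℕtoℚ (s w)) ÷ℕ M
    w+0≡w : w ℤ.+ + 0 ≡ w
    w+0≡w = ℤP.+-identityʳ w
    d<M : d w 0 < M
    d<M = subst (λ x → d w 0 < m ^ f x) w+0≡w (d-range w 0)

  Interleaved : ℤ → ℕ → Set
  Interleaved w u = Σ ℕ λ ρ → ρ < l ^ e w ×
                      k (w ℤ.+ ℤ.1ℤ) u ≡ ℕtoℚ (l ^ e w) ℚ.* k w (suc u) ℚ.+ ℕtoℚ ρ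

  -- At u = 0 this is the iteration itself, with digit r_w.
  interleave-base : ∀ w → Interleaved w 0
  interleave-base w = r w , r<l^e w , (begin
      k (w ℤ.+ ℤ.1ℤ) 0                                         ≡⟨ k-zero (w ℤ.+ ℤ.1ℤ) ⟩
      n (w ℤ.+ ℤ.1ℤ)                                           ≡⟨ n-rec w ⟩
      ℕtoℚ (l ^ e w) ℚ.* ((n w ℚ.- ℕtoℚ (s w)) ÷ℕ (m ^ f w)) ℚ.+ ℕtoℚ (r w)
                                                               ≡⟨ cong (λ t → ℕtoℚ (l ^ e w) ℚ.* t ℚ.+ ℕtoℚ (r w)) (first-quotient w) ⟨
      ℕtoℚ (l ^ e w) ℚ.* k w 1 ℚ.+ ℕtoℚ (r w)                 ∎)
    where
    open ≡-Reasoning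
    instance
      M≢0 : NonZero (m ^ f w)
      M≢0 = m^f≢0 w

  -- Passing to the next m-adic digit on both sides: the new digit is
  -- (l^{e_w} d_{w,u+1} + ρ − d_{w+1,u}) / m^{f_{w+u+1}}, an integer below l^{e_w}.
  interleave-step : ∀ w u → Interleaved w u → Interleaved w (suc u)
  interleave-step w u (ρ , ρ<L , k₁≡Lk₂+ρ) = conclude (integral-digit M X-integral MX≡A-d₁ d₁<M A<LM)
    where
    open ≡-Reasoning
    open +-*-Solver
    M = m ^ f (w ℤ.+ + suc u)
    L = l ^ e w
    instance
      M≢0 : NonZero M
      M≢0 = m^f≢0 (w ℤ.+ + suc u)
    y₁ = k (w ℤ.+ ℤ.1ℤ) (suc u)
    y₂ = k w (suc (suc u))
    d₁ = d (w ℤ.+ ℤ.1ℤ) u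
    d₂ = d w (suc u)
    X = y₁ ℚ.- ℕtoℚ L ℚ.* y₂
    -- both m-adic steps use the modulus m^{f_{w+u+1}}
    shift : w ℤ.+ ℤ.1ℤ ℤ.+ + u ≡ w ℤ.+ + suc u
    shift = ℤP.+-assoc w ℤ.1ℤ (+ u)
    d₁<M : d₁ < M
    d₁<M = subst (λ x → d₁ < m ^ f x) shift (d-range (w ℤ.+ ℤ.1ℤ) u)
    A<LM : L ℕ.* d₂ ℕ.+ ρ < L ℕ.* M
    A<LM = mixed-radix-< (d-range w (suc u)) ρ<L
    X-integral : Integral M X
    X-integral = integral-- (m-integral y₁ (k-in (w ℤ.+ ℤ.1ℤ) (suc u)) (f (w ℤ.+ + suc u)))
                            (integral-scale L (m-integral y₂ (k-in w (suc (suc u))) (f (w ℤ.+ + suc u))))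
    MX≡A-d₁ : ℕtoℚ M ℚ.* X ≡ ℕtoℚ (L ℕ.* d₂ ℕ.+ ρ) ℚ.- ℕtoℚ d₁
    MX≡A-d₁ = trans (interleave-algebra (ℕtoℚ M) (ℕtoℚ L) y₁ y₂ (ℕtoℚ d₁) (ℕtoℚ d₂) (ℕtoℚ ρ)
                                        (trans (k-step (w ℤ.+ ℤ.1ℤ) u) (cong (λ x → ℕtoℚ (m ^ f x) ℚ.* y₁ ℚ.+ ℕtoℚ d₁) shift))
                                        (k-step w (suc u)) k₁≡Lk₂+ρ)
                    (cong (ℚ._- ℕtoℚ d₁) (sym (trans (ℕtoℚ-+ (L ℕ.* d₂) ρ) (cong (ℚ._+ ℕtoℚ ρ) (ℕtoℚ-* L d₂)))))
    conclude : (Σ ℕ λ ρ' → ρ' < L × X ≡ ℕtoℚ ρ') → Interleaved w (suc u)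
    conclude (ρ' , ρ'<L , X≡ρ') = ρ' , ρ'<L , (begin
      y₁                           ≡⟨ solve 3 (λ y₁ L y₂ → y₁ := L :* y₂ :+ (y₁ :- L :* y₂)) refl y₁ (ℕtoℚ L) y₂ ⟩
      ℕtoℚ L ℚ.* y₂ ℚ.+ X          ≡⟨ cong (ℕtoℚ L ℚ.* y₂ ℚ.+_) X≡ρ' ⟩
      ℕtoℚ L ℚ.* y₂ ℚ.+ ℕtoℚ ρ'   ∎)

  interleave : ∀ w u → Interleaved w u
  interleave w zero = interleave-base w
  interleave w (suc u) = interleave-step w u (interleave w u)

  -- Inductively, both sides of the next l-adic step
  -- are divisions by l^{e_{v−1−u}} with remainder, so their quotients agree.
  j≡k : ∀ u v → j v u ≡ k (v ℤ.- + u) u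
  j≡k zero v = trans (j-zero v) (trans (sym (k-zero v)) (cong (λ x → k x 0) (sym (ℤP.+-identityʳ v))))
  j≡k (suc u) v = trans j≡k′ (cong (λ x → k x (suc u)) (sym (-suc v (+ u))))
    where
    open ≡-Reasoning
    w = v ℤ.- ℤ.1ℤ ℤ.- + u
    L = l ^ e w
    instance
      L≢0 : NonZero L
      L≢0 = l^e≢0 w
    ρ = proj₁ (interleave w u)
    both-divisions : ℕtoℚ L ℚ.* j v (suc u) ℚ.+ ℕtoℚ (b v u) ≡ ℕtoℚ L ℚ.* k w (suc u) ℚ.+ ℕtoℚ ρ
    both-divisions = begin
      ℕtoℚ L ℚ.* j v (suc u) ℚ.+ ℕtoℚ (b v u)    ≡⟨ j-step v u ⟨
      j v u                                      ≡⟨ j≡k u v ⟩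
      k (v ℤ.- + u) u                            ≡⟨ cong (λ x → k x u) (-1-+1 v (+ u)) ⟨
      k (w ℤ.+ ℤ.1ℤ) u                           ≡⟨ proj₂ (proj₂ (interleave w u)) ⟩
      ℕtoℚ L ℚ.* k w (suc u) ℚ.+ ℕtoℚ ρ          ∎
    j≡k′ : j v (suc u) ≡ k w (suc u)
    j≡k′ = euclid-unique L (j v (suc u)) (k w (suc u))
             (integral-- (l-integral (j v (suc u)) (j-in v (suc u)) (e w)) (l-integral (k w (suc u)) (k-in w (suc u)) (e w)))
             (b-range v u) (proj₁ (proj₂ (interleave w u))) both-divisions

  λ-expansion : ∀ v u → n v ≡ ℕtoℚ (λres v u) ℚ.+ ℕtoℚ (l ^ Ē v u) ℚ.* j v u
  λ-expansion v zero = trans (sym (j-zero v)) (solve 1 (λ x → x := con (ℕtoℚ 0) :+ con (ℕtoℚ 1) :* x) refl (j v 0))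
    where open +-*-Solver
  λ-expansion v (suc u) = begin
      n v                                                 ≡⟨ λ-expansion v u ⟩
      ℕtoℚ Λ ℚ.+ ℕtoℚ P ℚ.* j v u                         ≡⟨ cong (λ t → ℕtoℚ Λ ℚ.+ ℕtoℚ P ℚ.* t) (j-step v u) ⟩
      ℕtoℚ Λ ℚ.+ ℕtoℚ P ℚ.* (ℕtoℚ E ℚ.* j v (suc u) ℚ.+ ℕtoℚ (b v u))
        ≡⟨ solve 5 (λ Λ P E x c → Λ :+ P :* (E :* x :+ c) := (Λ :+ P :* c) :+ (P :* E) :* x)
             refl (ℕtoℚ Λ) (ℕtoℚ P) (ℕtoℚ E) (j v (suc u)) (ℕtoℚ (b v u)) ⟩
      (ℕtoℚ Λ ℚ.+ ℕtoℚ P ℚ.* ℕtoℚ (b v u)) ℚ.+ (ℕtoℚ P ℚ.* ℕtoℚ E) ℚ.* j v (suc u)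
        ≡⟨ cong₂ (λ p q → p ℚ.+ q ℚ.* j v (suc u)) next-residue next-power ⟩
      ℕtoℚ (λres v (suc u)) ℚ.+ ℕtoℚ (l ^ Ē v (suc u)) ℚ.* j v (suc u)
        ∎
    where
    open ≡-Reasoning
    open +-*-Solver
    Λ = λres v u
    P = l ^ Ē v u
    E = l ^ e (v ℤ.- ℤ.1ℤ ℤ.- + u)
    next-residue : ℕtoℚ Λ ℚ.+ ℕtoℚ P ℚ.* ℕtoℚ (b v u) ≡ ℕtoℚ (λres v (suc u))
    next-residue = sym (trans (ℕtoℚ-+ Λ (P ℕ.* b v u)) (cong (ℕtoℚ Λ ℚ.+_) (ℕtoℚ-* P (b v u))))
    next-power : ℕtoℚ P ℚ.* ℕtoℚ E ≡ ℕtoℚ (l ^ Ē v (suc u))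
    next-power = sym (trans (cong ℕtoℚ (ℕP.^-distribˡ-+-* l (Ē v u) (e (v ℤ.- ℤ.1ℤ ℤ.- + u)))) (ℕtoℚ-* P E))

  Ē-shift : ∀ v u → Ē (v ℤ.+ ℤ.1ℤ) (suc u) ≡ e v ℕ.+ Ē v u
  Ē-shift v zero = trans (cong e (trans (+1-1 v (+ 0)) (ℤP.+-identityʳ v))) (sym (ℕP.+-identityʳ (e v)))
  Ē-shift v (suc u) = trans (cong₂ ℕ._+_ (Ē-shift v u) (cong e (trans (+1-1 v (+ suc u)) (-suc v (+ u)))))
                            (ℕP.+-assoc (e v) (Ē v u) (e (v ℤ.- ℤ.1ℤ ℤ.- + u)))

  j-descent : ∀ v u → j v u ≡ ℕtoℚ (m ^ f v) ℚ.* j (v ℤ.+ ℤ.1ℤ) (suc u) ℚ.+ ℕtoℚ (d (v ℤ.- + u) u)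
  j-descent v u = begin
      j v u                                         ≡⟨ j≡k u v ⟩
      k w u                                         ≡⟨ k-step w u ⟩
      ℕtoℚ (m ^ f (w ℤ.+ + u)) ℚ.* k w (suc u) ℚ.+ ℕtoℚ (d w u)
        ≡⟨ cong₂ (λ x y → ℕtoℚ (m ^ f x) ℚ.* y ℚ.+ ℕtoℚ (d w u)) (-+-cancel v (+ u)) (sym j′≡k) ⟩
      ℕtoℚ (m ^ f v) ℚ.* j (v ℤ.+ ℤ.1ℤ) (suc u) ℚ.+ ℕtoℚ (d w u) ∎
    where
    open ≡-Reasoning
    w = v ℤ.- + u
    j′≡k : j (v ℤ.+ ℤ.1ℤ) (suc u) ≡ k w (suc u)
    j′≡k = trans (j≡k (suc u) (v ℤ.+ ℤ.1ℤ)) (cong (λ x → k x (suc u)) (+1-suc v (+ u)))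

  -- In terms of digits, λ_{v,u+1} + l^{Ē_{v,u}} c_{v−u−1,u+1} = λ_{v,u} + l^{Ē_{v,u}} d_{v−u,u}:
  -- the digit b_{v,u} added to the residue is cancelled by the digit difference.
  residue-digit : ∀ v u → + λres v (suc u) ℤ.+ + (l ^ Ē v u) ℤ.* c (v ℤ.- + suc u) (suc u)
                           ≡ + λres v u ℤ.+ + (l ^ Ē v u) ℤ.* + d (v ℤ.- + u) u
  residue-digit v u = begin
      + λres v (suc u) ℤ.+ + P ℤ.* c (v ℤ.- + suc u) (suc u)
        ≡⟨ cong₂ (λ x y → x ℤ.+ + P ℤ.* y) residue-step digit-difference ⟩
      (+ Λ ℤ.+ + P ℤ.* + b v u) ℤ.+ + P ℤ.* (+ d w u ℤ.- + b v u)
        ≡⟨ cancel-b (+ Λ) (+ P) (+ b v u) (+ d w u) ⟩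
      + Λ ℤ.+ + P ℤ.* + d w u
        ∎
    where
    open ≡-Reasoning
    Λ = λres v u
    P = l ^ Ē v u
    w = v ℤ.- + u
    residue-step : + λres v (suc u) ≡ + Λ ℤ.+ + P ℤ.* + b v u
    residue-step = trans (ℤP.pos-+ Λ (P ℕ.* b v u)) (cong (ℤ._+_ (+ Λ)) (ℤP.pos-* P (b v u)))
    digit-difference : c (v ℤ.- + suc u) (suc u) ≡ + d w u ℤ.- + b v u
    digit-difference = cong₂ (λ x y → + d x u ℤ.- + b y u)
                         (trans (cong (ℤ._+ ℤ.1ℤ) (-suc v (+ u))) (-1-+1 v (+ u))) (-+-cancel v (+ suc u))
    cancel-b : ∀ Λ P b d → (Λ ℤ.+ P ℤ.* b) ℤ.+ P ℤ.* (d ℤ.- b) ≡ Λ ℤ.+ P ℤ.* d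
    cancel-b = ℤ-solve-∀

  -- The lemma with the denominator l^{e_v} cleared, in the digit form of its right-hand side.
  cleared-identity : ∀ v u →
    ℤtoℚ (+ (m ^ f v ℕ.* λres (v ℤ.+ ℤ.1ℤ) (suc u)) ℤ.+ a v)
      ≡ ℕtoℚ (l ^ e v) ℚ.* ℤtoℚ (+ λres v u ℤ.+ + (l ^ Ē v u) ℤ.* + d (v ℤ.- + u) u)
  cleared-identity v u = begin
      ℤtoℚ (+ (M ℕ.* Λ₁) ℤ.+ a v)                        ≡⟨ ℤtoℚ-+ (+ (M ℕ.* Λ₁)) (a v) ⟩
      ℕtoℚ (M ℕ.* Λ₁) ℚ.+ ℤtoℚ (a v)                     ≡⟨ cong (ℚ._+ ℤtoℚ (a v)) (ℕtoℚ-* M Λ₁) ⟩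
      ℕtoℚ M ℚ.* ℕtoℚ Λ₁ ℚ.+ ℤtoℚ (a v)                  ≡⟨ carry (ℕtoℚ L) (ℕtoℚ M) (ℕtoℚ P) J (ℕtoℚ d′) (ℤtoℚ (a v)) (ℕtoℚ Λ₀) (ℕtoℚ Λ₁)
                                                               expansion-here expansion-next (iterate-relation v) ⟩
      ℕtoℚ L ℚ.* (ℕtoℚ Λ₀ ℚ.+ ℕtoℚ P ℚ.* ℕtoℚ d′)       ≡⟨ cong (ℕtoℚ L ℚ.*_) rhs-cast ⟨
      ℕtoℚ L ℚ.* ℤtoℚ (+ Λ₀ ℤ.+ + P ℤ.* + d′)           ∎
    where
    open ≡-Reasoning
    M = m ^ f v
    L = l ^ e v
    P = l ^ Ē v u
    Λ₀ = λres v u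
    Λ₁ = λres (v ℤ.+ ℤ.1ℤ) (suc u)
    d′ = d (v ℤ.- + u) u
    J = j (v ℤ.+ ℤ.1ℤ) (suc u)
    expansion-here : n v ≡ ℕtoℚ Λ₀ ℚ.+ ℕtoℚ P ℚ.* (ℕtoℚ M ℚ.* J ℚ.+ ℕtoℚ d′)
    expansion-here = trans (λ-expansion v u) (cong (λ t → ℕtoℚ Λ₀ ℚ.+ ℕtoℚ P ℚ.* t) (j-descent v u))
    expansion-next : n (v ℤ.+ ℤ.1ℤ) ≡ ℕtoℚ Λ₁ ℚ.+ (ℕtoℚ L ℚ.* ℕtoℚ P) ℚ.* J
    expansion-next = trans (λ-expansion (v ℤ.+ ℤ.1ℤ) (suc u)) (cong (λ t → ℕtoℚ Λ₁ ℚ.+ t ℚ.* J)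
      (trans (cong (λ x → ℕtoℚ (l ^ x)) (Ē-shift v u)) (trans (cong ℕtoℚ (ℕP.^-distribˡ-+-* l (e v) (Ē v u))) (ℕtoℚ-* L P))))
    rhs-cast : ℤtoℚ (+ Λ₀ ℤ.+ + P ℤ.* + d′) ≡ ℕtoℚ Λ₀ ℚ.+ ℕtoℚ P ℚ.* ℕtoℚ d′
    rhs-cast = trans (ℤtoℚ-+ (+ Λ₀) (+ P ℤ.* + d′)) (cong (ℕtoℚ Λ₀ ℚ.+_) (ℤtoℚ-* (+ P) (+ d′)))

lemma4p8 : (S : Setting) (D : Digits S) →
    let open Setting S in
    let open Digits D in
    ∀ (v : ℕ) → v < τ → ∀ (u : ℕ) → 1 ≤ u →
    _/_ ((+ (m ^ f (+ v) ℕ.* λres (+ v ℤ.+ ℤ.1ℤ) u)) ℤ.+ a (+ v)) (l ^ e (+ v)) {{powNZ 2≤l (e (+ v))}}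
    ≡ ℤtoℚ ((+ λres (+ v) u) ℤ.+ (+ (l ^ Ē (+ v) (u ∸ 1))) ℤ.* c (+ v ℤ.- + u) u)
lemma4p8 S D v _ (suc u) _ = /-unique Z L (ℤtoℚ R) (begin
    ℤtoℚ Z                                                          ≡⟨ cleared-identity (+ v) u ⟩
    ℕtoℚ L ℚ.* ℤtoℚ (+ λres (+ v) u ℤ.+ + P ℤ.* + d (+ v ℤ.- + u) u)  ≡⟨ cong (λ t → ℕtoℚ L ℚ.* ℤtoℚ t) (residue-digit (+ v) u) ⟨
    ℕtoℚ L ℚ.* ℤtoℚ R                                               ∎)
  where
  open Setting S
  open Digits D
  open DigitIdentities S D
  open ≡-Reasoning
  L = l ^ e (+ v)
  P = l ^ Ē (+ v) u
  Z = + (m ^ f (+ v) ℕ.* λres (+ v ℤ.+ ℤ.1ℤ) (suc u)) ℤ.+ a (+ v)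
  R = + λres (+ v) (suc u) ℤ.+ + P ℤ.* c (+ v ℤ.- + suc u) (suc u)
  instance
    L≢0 : NonZero L
    L≢0 = l^e≢0 (+ v)
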